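{- Let $r$ and $s$ be closed representable terms and let $P(x)$ be a formula with one free variable. Then the sentence $r=s\to(P(r)\leftrightarrow P(s))$ (with all representable function symbols expanded according to the convention below) is logically valid.
   Context: Fix a theory $\mathsf{T}$ and formulas $\varphi_f$ (with $k+1$ free variables) representing functions $f\colon\mathbb{N}^k\to\mathbb{N}$ in $\mathsf{T}$. A representable function symbol $f$ may appear in formulas anywhere an ordinary $k$-ary function symbol could; terms built with them are representable terms. Such expressions abbreviate ordinary formulas as follows: write the expression as $Q(f(\mathbf t))$ where $f(\mathbf t)$ is an innermost occurrence of a representable function symbol (so $\mathbf t$ are ordinary terms) and $Q$ is the smallest subformula containing it; replace $Q(f(\mathbf t))$ by $(\exists! y\,\varphi_f(\mathbf t,y))\land\exists y\,(\varphi_f(\mathbf t,y)\land Q(y))$, where $\exists!y\,R(y)$ abbreviates $\exists y\,(R(y)\land\forall w\,(R(w)\to w=y))$; repeat until no representable function symbols remain. Representable terms are expanded before any abbreviated predicate symbols are unfolded (here $P(r)$ is treated with $P$ as an atomic predicate during expansion, so e.g. $P(r)$ expands with the quantifiers outside $P$). -}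

module Defs where

open import Data.Nat using (ℕ; zero; suc)
open import Data.Fin using (Fin; zero; suc)
open import Data.Vec using (Vec; []; _∷_; lookup)
open import Data.Empty using (⊥)
open import Data.Product using (Σ; _×_)
open import Data.Sum using (_⊎_)
open import Relation.Nullary using (¬_)
open import Relation.Binary.PropositionalEquality using (_≡_)

record Lang : Set₁ where
  field
    Fun      : Set
    funArity : Fun → ℕ
    Rel      : Set
    relArity : Rel → ℕ

Ren : ℕ → ℕ → Set
Ren n m = Fin n → Fin m

liftR : ∀ {n m} → Ren n m → Ren (suc n) (suc m)
liftR ρ zero    = zero
liftR ρ (suc i) = suc (ρ i)

module _ (L : Lang) where
  open Lang L

  data Term (n : ℕ) : Set where
    var : Fin n → Term n
    fun : (f : Fun) → Vec (Term n) (funArity f) → Term n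

  infixr 4 _⇒_
  infixr 5 _∧_ _∨_
  infix 6 _≐_
  data Formula (n : ℕ) : Set where
    rel  : (R : Rel) → Vec (Term n) (relArity R) → Formula n
    _≐_  : Term n → Term n → Formula n
    ⊥'   : Formula n
    ¬'_  : Formula n → Formula n
    _∧_  : Formula n → Formula n → Formula n
    _∨_  : Formula n → Formula n → Formula n
    _⇒_  : Formula n → Formula n → Formula n
    ∀'   : Formula (suc n) → Formula n
    ∃'   : Formula (suc n) → Formula n

  mutual
    renT : ∀ {n m} → Ren n m → Term n → Term m
    renT ρ (var x)    = var (ρ x)
    renT ρ (fun f ts) = fun f (renTs ρ ts)

    renTs : ∀ {n m k} → Ren n m → Vec (Term n) k → Vec (Term m) k
    renTs ρ []       = []
    renTs ρ (t ∷ ts) = renT ρ t ∷ renTs ρ ts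

  renF : ∀ {n m} → Ren n m → Formula n → Formula m
  renF ρ (rel R ts) = rel R (renTs ρ ts)
  renF ρ (t ≐ u)    = renT ρ t ≐ renT ρ u
  renF ρ ⊥'         = ⊥'
  renF ρ (¬' φ)     = ¬' renF ρ φ
  renF ρ (φ ∧ ψ)    = renF ρ φ ∧ renF ρ ψ
  renF ρ (φ ∨ ψ)    = renF ρ φ ∨ renF ρ ψ
  renF ρ (φ ⇒ ψ)    = renF ρ φ ⇒ renF ρ ψ
  renF ρ (∀' φ)     = ∀' (renF (liftR ρ) φ)
  renF ρ (∃' φ)     = ∃' (renF (liftR ρ) φ)

  Sub : ℕ → ℕ → Set
  Sub n m = Fin n → Term m

  liftS : ∀ {n m} → Sub n m → Sub (suc n) (suc m)
  liftS σ zero    = var zero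
  liftS σ (suc i) = renT suc (σ i)

  mutual
    subT : ∀ {n m} → Sub n m → Term n → Term m
    subT σ (var x)    = σ x
    subT σ (fun f ts) = fun f (subTs σ ts)

    subTs : ∀ {n m k} → Sub n m → Vec (Term n) k → Vec (Term m) k
    subTs σ []       = []
    subTs σ (t ∷ ts) = subT σ t ∷ subTs σ ts

  subF : ∀ {n m} → Sub n m → Formula n → Formula m
  subF σ (rel R ts) = rel R (subTs σ ts)
  subF σ (t ≐ u)    = subT σ t ≐ subT σ u
  subF σ ⊥'         = ⊥'
  subF σ (¬' φ)     = ¬' subF σ φ
  subF σ (φ ∧ ψ)    = subF σ φ ∧ subF σ ψ
  subF σ (φ ∨ ψ)    = subF σ φ ∨ subF σ ψ
  subF σ (φ ⇒ ψ)    = subF σ φ ⇒ subF σ ψ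
  subF σ (∀' φ)     = ∀' (subF (liftS σ) φ)
  subF σ (∃' φ)     = ∃' (subF (liftS σ) φ)

  -- ∃! y R(y)  :=  ∃ y (R(y) ∧ ∀ w (R(w) → w = y))
  -- (inside ∀ w: w = var 0, y = var 1)
  ∃!' : ∀ {n} → Formula (suc n) → Formula n
  ∃!' R = ∃' (R ∧ ∀' (renF wk R ⇒ (var zero ≐ var (suc zero))))
    where
      wk : ∀ {n} → Ren (suc n) (suc (suc n))
      wk zero    = zero
      wk (suc i) = suc (suc i)

  -- Classical Tarskian semantics, rendered via the Gödel–Gentzen
  -- negative translation (¬¬ on atoms, ∨ and ∃), so that under a
  -- classical metatheory it coincides with ordinary classical truth.

  record Structure : Set₁ where
    field
      Carrier : Set
      point   : Carrier        -- domains are nonempty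
      funI    : (f : Fun) → Vec Carrier (funArity f) → Carrier
      relI    : (R : Rel) → Vec Carrier (relArity R) → Set

  module _ (M : Structure) where
    open Structure M

    mutual
      eval : ∀ {n} → (Fin n → Carrier) → Term n → Carrier
      eval e (var x)    = e x
      eval e (fun f ts) = funI f (evals e ts)

      evals : ∀ {n k} → (Fin n → Carrier) → Vec (Term n) k → Vec Carrier k
      evals e []       = []
      evals e (t ∷ ts) = eval e t ∷ evals e ts

    extend : ∀ {n} → (Fin n → Carrier) → Carrier → Fin (suc n) → Carrier
    extend e d zero    = d
    extend e d (suc i) = e i

    Sat : ∀ {n} → (Fin n → Carrier) → Formula n → Set
    Sat e (rel R ts) = ¬ ¬ relI R (evals e ts)
    Sat e (t ≐ u)    = ¬ ¬ (eval e t ≡ eval e u)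
    Sat e ⊥'         = ⊥
    Sat e (¬' φ)     = ¬ Sat e φ
    Sat e (φ ∧ ψ)    = Sat e φ × Sat e ψ
    Sat e (φ ∨ ψ)    = ¬ ¬ (Sat e φ ⊎ Sat e ψ)
    Sat e (φ ⇒ ψ)    = Sat e φ → Sat e ψ
    Sat e (∀' φ)     = (d : Carrier) → Sat (extend e d) φ
    Sat e (∃' φ)     = ¬ ¬ Σ Carrier (λ d → Sat (extend e d) φ)

  Valid : Formula 0 → Set₁
  Valid φ = (M : Structure) → Sat M (λ ()) φ

  -- Representable function symbols: each f has an arity k and a
  -- formula φ_f with k+1 free variables; in φ_f the variable var zero
  -- is the output y and var (suc i) is the i-th argument.
  -- (No hypothesis relating φ_f to a theory T is needed for validity.)

  record Reps : Set₁ where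
    field
      RFun   : Set
      rArity : RFun → ℕ
      defn   : (f : RFun) → Formula (suc (rArity f))

  module _ (Rp : Reps) where
    open Reps Rp

    data XTerm (n : ℕ) : Set where
      var  : Fin n → XTerm n
      fun  : (f : Fun) → Vec (XTerm n) (funArity f) → XTerm n
      rfun : (f : RFun) → Vec (XTerm n) (rArity f) → XTerm n

    -- formulas that may contain representable terms, and an
    -- "abbreviated predicate" application P(t) of a formula P(x)
    -- with one free variable, treated as atomic during expansion
    data XFormula (n : ℕ) : Set where
      rel  : (R : Rel) → Vec (XTerm n) (relArity R) → XFormula n
      _≐_  : XTerm n → XTerm n → XFormula n
      app  : XFormula 1 → XTerm n → XFormula n
      ⊥'   : XFormula n
      ¬'_  : XFormula n → XFormula n
      _∧_  : XFormula n → XFormula n → XFormula n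
      _∨_  : XFormula n → XFormula n → XFormula n
      _⇒_  : XFormula n → XFormula n → XFormula n
      ∀'   : XFormula (suc n) → XFormula n
      ∃'   : XFormula (suc n) → XFormula n

    _⇔_ : ∀ {n} → XFormula n → XFormula n → XFormula n
    A ⇔ B = (A ⇒ B) ∧ (B ⇒ A)

    Cont : ℕ → Set → Set
    Cont m A = ∀ {m'} → Ren m m' → A → Formula m'

    -- one expansion step for an innermost occurrence f(us), us ordinary:
    --   Q(f(us))  ↦  (∃! y φ_f(us,y)) ∧ ∃ y (φ_f(us,y) ∧ Q(y))
    repStep : ∀ {m} (f : RFun) → Vec (Term m) (rArity f)
            → (∀ {m'} → Ren m m' → Term m' → Formula m') → Formula m
    repStep {m} f us K = ∃!' φ ∧ ∃' (φ ∧ K suc (var zero))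
      where
        σ : Fin (suc (rArity f)) → Term (suc m)
        σ zero    = var zero
        σ (suc i) = renT suc (lookup us i)
        φ : Formula (suc m)
        φ = subF σ (defn f)

    -- Expansion of the representable symbols of a term, leftmost
    -- innermost occurrence first; K builds the enclosing (atomic)
    -- formula Q from the resulting ordinary term.
    mutual
      expT : ∀ {n m} → XTerm n → Ren n m
           → (∀ {m'} → Ren m m' → Term m' → Formula m') → Formula m
      expT (var x)     ρ K = K (λ i → i) (var (ρ x))
      expT (fun f ts)  ρ K = expTs ts ρ (λ σ us → K σ (fun f us))
      expT (rfun f ts) ρ K = expTs ts ρ (λ σ us → repStep f us (λ τ y → K (λ i → τ (σ i)) y))

      expTs : ∀ {n m k} → Vec (XTerm n) k → Ren n m
            → (∀ {m'} → Ren m m' → Vec (Term m') k → Formula m') → Formula m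
      expTs []       ρ K = K (λ i → i) []
      expTs (t ∷ ts) ρ K =
        expT t ρ (λ σ u → expTs ts (λ i → σ (ρ i))
                   (λ τ us → K (λ i → τ (σ i)) (renT τ u ∷ us)))

    inst : ∀ {m} → Formula 1 → Term m → Formula m
    inst φ a = subF (λ { zero → a }) φ

    expF : ∀ {n} → XFormula n → Formula n
    expF (rel R ts) = expTs ts (λ i → i) (λ σ us → rel R us)
    expF (t ≐ u)    = expT t (λ i → i) (λ σ a → expT u σ (λ τ b → renT τ a ≐ b))
    expF (app P t)  = expT t (λ i → i) (λ σ a → inst (expF P) a)
    expF ⊥'         = ⊥'
    expF (¬' φ)     = ¬' expF φ
    expF (φ ∧ ψ)    = expF φ ∧ expF ψ
    expF (φ ∨ ψ)    = expF φ ∨ expF ψ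
    expF (φ ⇒ ψ)    = expF φ ⇒ expF ψ
    expF (∀' φ)     = ∀' (expF φ)
    expF (∃' φ)     = ∃' (expF φ)

{-# OPTIONS --safe #-}
-- Expanding a representable term t inside an atomic context Q yields a formula equivalent to
-- "t denotes some d and Q(d)" (Sat-expT), where f(ts) denotes d when ts denote ds and d is the
-- unique witness of φ_f(ds, -): the expansion ∃!y φ_f ∧ ∃y (φ_f ∧ Q y) says precisely that this
-- unique witness satisfies Q. Denotations are unique, so if r = s holds then r and s denote a
-- common value a, and P(r) and P(s) are both equivalent to P(a). Since Sat is the negative
-- translation all of this holds only under ¬¬, which is harmless because satisfaction is ¬¬-stable.
module Submission where

open import Defs
open import Level using (0ℓ)
open import Data.Nat using (ℕ; suc)
open import Data.Fin using (Fin; zero; suc)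
open import Data.Vec using (Vec; []; _∷_; lookup)
open import Data.Unit using (⊤)
open import Data.Product using (Σ-syntax; ∃; _×_; _,_; proj₁; proj₂)
open import Data.Product.Function.NonDependent.Propositional using (_×-⇔_)
open import Data.Sum.Function.Propositional using (_⊎-⇔_)
open import Effect.Monad using (RawMonad)
open import Function using (_∘_; _$_; id; const)
open import Function.Bundles using (mk⇔; module Equivalence) renaming (_⇔_ to _⟺_)
open import Function.Construct.Composition using (_⇔-∘_)
open import Function.Construct.Identity using (⇔-id)
open import Function.Construct.Symmetry using (⇔-sym)
open import Function.Related.TypeIsomorphisms using (→-cong-⇔; ¬-cong-⇔)
open import Relation.Nullary using (¬_)
open import Relation.Nullary.Negation using (Stable; negated-stable; ¬¬-map; ¬¬-Monad)
open import Relation.Binary.PropositionalEquality using (_≡_; refl; trans; cong; cong₂; _≗_)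

open Equivalence using (to; from)
open RawMonad (¬¬-Monad {a = 0ℓ}) using (pure; _>>=_; _<$>_)

≡⇒⇔ : {A B : Set} → A ≡ B → A ⟺ B
≡⇒⇔ refl = ⇔-id _

¬¬-cong-⇔ : {A B : Set} → A ⟺ B → (¬ ¬ A) ⟺ (¬ ¬ B)
¬¬-cong-⇔ = ¬-cong-⇔ ∘ ¬-cong-⇔

Π-cong-⇔ : {A : Set} {P Q : A → Set} → (∀ x → P x ⟺ Q x) → (∀ x → P x) ⟺ (∀ x → Q x)
Π-cong-⇔ P⇔Q = mk⇔ (λ p x → P⇔Q x .to (p x)) (λ q x → P⇔Q x .from (q x))

Σ-cong-⇔ : {A : Set} {P Q : A → Set} → (∀ x → P x ⟺ Q x) → ∃ P ⟺ ∃ Q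
Σ-cong-⇔ P⇔Q = mk⇔ (λ (x , p) → x , P⇔Q x .to p) (λ (x , q) → x , P⇔Q x .from q)

-- Uniqueness up to ¬¬, as delivered by the negative translation of ∃!.
Unique : {A : Set} → (A → Set) → A → Set
Unique P x = P x × (∀ y → P y → ¬ ¬ y ≡ x)

Unique-cong-⇔ : {A : Set} {P Q : A → Set} → (∀ x → P x ⟺ Q x) → ∀ x → Unique P x ⟺ Unique Q x
Unique-cong-⇔ P⇔Q x = P⇔Q x ×-⇔ Π-cong-⇔ λ y → →-cong-⇔ (P⇔Q y) (⇔-id _)

∃!-and-∃⇔ : {A : Set} {P Q : A → Set}
          → ((¬ ¬ ∃ (Unique P)) × (¬ ¬ ∃ λ x → P x × Q x)) ⟺ (¬ ¬ ∃ λ x → Unique P x × Q x)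
∃!-and-∃⇔ = mk⇔
  (λ (∃!P , ∃PQ) → do
    (x , P!x@(_ , uniq)) ← ∃!P
    (y , Py , Qy) ← ∃PQ
    refl ← uniq y Py
    pure (x , P!x , Qy))
  (λ h → (do (x , P!x , _) ← h ; pure (x , P!x))
       , (do (x , (Px , _) , Qx) ← h ; pure (x , Px , Qx)))

module Satisfaction {L : Lang} (M : Structure L) where
  open Lang L
  open Structure M

  Env : ℕ → Set
  Env n = Fin n → Carrier

  infix 3 _⊨_
  _⊨_ : ∀ {n} → Env n → Formula L n → Set
  e ⊨ φ = Sat L M e φ

  Sat-stable : ∀ {n} (e : Env n) φ → Stable (e ⊨ φ)
  Sat-stable e (rel R ts)   = negated-stable
  Sat-stable e (t ≐ u)      = negated-stable
  Sat-stable e ⊥'         h = h id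
  Sat-stable e (¬' φ)       = negated-stable
  Sat-stable e (φ ∧ ψ)    h = Sat-stable e φ (¬¬-map proj₁ h) , Sat-stable e ψ (¬¬-map proj₂ h)
  Sat-stable e (φ ∨ ψ)      = negated-stable
  Sat-stable e (φ ⇒ ψ)  h a = Sat-stable e ψ (¬¬-map (_$ a) h)
  Sat-stable e (∀' φ)   h d = Sat-stable (extend L M e d) φ (¬¬-map (_$ d) h)
  Sat-stable e (∃' φ)       = negated-stable

  mutual
    eval-renT : ∀ {n m} {ρ : Ren n m} {e : Env m} {e' : Env n} → e ∘ ρ ≗ e'
              → ∀ t → eval L M e (renT L ρ t) ≡ eval L M e' t
    eval-renT eq (var x)    = eq x
    eval-renT eq (fun f ts) = cong (funI f) (evals-renTs eq ts)

    evals-renTs : ∀ {n m k} {ρ : Ren n m} {e : Env m} {e' : Env n} → e ∘ ρ ≗ e'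
                → (ts : Vec (Term L n) k) → evals L M e (renTs L ρ ts) ≡ evals L M e' ts
    evals-renTs eq []       = refl
    evals-renTs eq (t ∷ ts) = cong₂ _∷_ (eval-renT eq t) (evals-renTs eq ts)

  mutual
    eval-subT : ∀ {n m} {σ : Sub L n m} {e : Env m} {e' : Env n} → eval L M e ∘ σ ≗ e'
              → ∀ t → eval L M e (subT L σ t) ≡ eval L M e' t
    eval-subT eq (var x)    = eq x
    eval-subT eq (fun f ts) = cong (funI f) (evals-subTs eq ts)

    evals-subTs : ∀ {n m k} {σ : Sub L n m} {e : Env m} {e' : Env n} → eval L M e ∘ σ ≗ e'
                → (ts : Vec (Term L n) k) → evals L M e (subTs L σ ts) ≡ evals L M e' ts
    evals-subTs eq []       = refl
    evals-subTs eq (t ∷ ts) = cong₂ _∷_ (eval-subT eq t) (evals-subTs eq ts)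

  lookup-evals : ∀ {n k} {e : Env n} (ts : Vec (Term L n) k) i
               → eval L M e (lookup ts i) ≡ lookup (evals L M e ts) i
  lookup-evals (t ∷ ts) zero    = refl
  lookup-evals (t ∷ ts) (suc i) = lookup-evals ts i

  extend-liftR : ∀ {n m} {ρ : Ren n m} {e : Env m} {e' : Env n} → e ∘ ρ ≗ e'
               → ∀ d → extend L M e d ∘ liftR ρ ≗ extend L M e' d
  extend-liftR eq d zero    = refl
  extend-liftR eq d (suc i) = eq i

  extend-liftS : ∀ {n m} {σ : Sub L n m} {e : Env m} {e' : Env n} → eval L M e ∘ σ ≗ e'
               → ∀ d → eval L M (extend L M e d) ∘ liftS L σ ≗ extend L M e' d
  extend-liftS     eq d zero    = refl
  extend-liftS {σ = σ} eq d (suc i) = trans (eval-renT (λ _ → refl) (σ i)) (eq i)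

  Sat-renF : ∀ {n m} {ρ : Ren n m} {e : Env m} {e' : Env n} → e ∘ ρ ≗ e'
           → ∀ φ → (e ⊨ renF L ρ φ) ⟺ (e' ⊨ φ)
  Sat-renF eq (rel R ts) = ¬¬-cong-⇔ (≡⇒⇔ (cong (relI R) (evals-renTs eq ts)))
  Sat-renF eq (t ≐ u)    = ¬¬-cong-⇔ (≡⇒⇔ (cong₂ _≡_ (eval-renT eq t) (eval-renT eq u)))
  Sat-renF eq ⊥'         = ⇔-id _
  Sat-renF eq (¬' φ)     = ¬-cong-⇔ (Sat-renF eq φ)
  Sat-renF eq (φ ∧ ψ)    = Sat-renF eq φ ×-⇔ Sat-renF eq ψ
  Sat-renF eq (φ ∨ ψ)    = ¬¬-cong-⇔ (Sat-renF eq φ ⊎-⇔ Sat-renF eq ψ)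
  Sat-renF eq (φ ⇒ ψ)    = →-cong-⇔ (Sat-renF eq φ) (Sat-renF eq ψ)
  Sat-renF eq (∀' φ)     = Π-cong-⇔ λ d → Sat-renF (extend-liftR eq d) φ
  Sat-renF eq (∃' φ)     = ¬¬-cong-⇔ (Σ-cong-⇔ λ d → Sat-renF (extend-liftR eq d) φ)

  Sat-subF : ∀ {n m} {σ : Sub L n m} {e : Env m} {e' : Env n} → eval L M e ∘ σ ≗ e'
           → ∀ φ → (e ⊨ subF L σ φ) ⟺ (e' ⊨ φ)
  Sat-subF eq (rel R ts) = ¬¬-cong-⇔ (≡⇒⇔ (cong (relI R) (evals-subTs eq ts)))
  Sat-subF eq (t ≐ u)    = ¬¬-cong-⇔ (≡⇒⇔ (cong₂ _≡_ (eval-subT eq t) (eval-subT eq u)))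
  Sat-subF eq ⊥'         = ⇔-id _
  Sat-subF eq (¬' φ)     = ¬-cong-⇔ (Sat-subF eq φ)
  Sat-subF eq (φ ∧ ψ)    = Sat-subF eq φ ×-⇔ Sat-subF eq ψ
  Sat-subF eq (φ ∨ ψ)    = ¬¬-cong-⇔ (Sat-subF eq φ ⊎-⇔ Sat-subF eq ψ)
  Sat-subF eq (φ ⇒ ψ)    = →-cong-⇔ (Sat-subF eq φ) (Sat-subF eq ψ)
  Sat-subF eq (∀' φ)     = Π-cong-⇔ λ d → Sat-subF (extend-liftS eq d) φ
  Sat-subF eq (∃' φ)     = ¬¬-cong-⇔ (Σ-cong-⇔ λ d → Sat-subF (extend-liftS eq d) φ)

  Sat-∃! : ∀ {n} {e : Env n} φ → (e ⊨ ∃!' L φ) ⟺ (¬ ¬ ∃ (Unique λ d → extend L M e d ⊨ φ))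
  Sat-∃! φ = ¬¬-cong-⇔ $ Σ-cong-⇔ λ d → ⇔-id _ ×-⇔ Π-cong-⇔ λ w →
    →-cong-⇔ (Sat-renF (λ { zero → refl ; (suc i) → refl }) φ) (⇔-id _)

  Sat-∃!∧∃ : ∀ {n} {e : Env n} φ ψ
           → (e ⊨ ∃!' L φ ∧ ∃' (φ ∧ ψ))
             ⟺ (¬ ¬ ∃ λ d → Unique (λ w → extend L M e w ⊨ φ) d × (extend L M e d ⊨ ψ))
  Sat-∃!∧∃ φ ψ = ∃!-and-∃⇔ ⇔-∘ (Sat-∃! φ ×-⇔ ⇔-id _)

module Expansion {L : Lang} (Rp : Reps L) (M : Structure L) where
  open Lang L
  open Reps Rp
  open Structure M
  open Satisfaction M public

  Graph : (f : RFun) → Vec Carrier (rArity f) → Carrier → Set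
  Graph f ds d = lookup (d ∷ ds) ⊨ defn f

  IsValue : (f : RFun) → Vec Carrier (rArity f) → Carrier → Set
  IsValue f ds = Unique (Graph f ds)

  mutual
    Denotes : ∀ {n} → Env n → XTerm L Rp n → Carrier → Set
    Denotes e (var x)     d = e x ≡ d
    Denotes e (fun f ts)  d = Σ[ ds ∈ Vec Carrier (funArity f) ] Denotes* e ts ds × funI f ds ≡ d
    Denotes e (rfun f ts) d = Σ[ ds ∈ Vec Carrier (rArity f) ] Denotes* e ts ds × IsValue f ds d

    Denotes* : ∀ {n k} → Env n → Vec (XTerm L Rp n) k → Vec Carrier k → Set
    Denotes* e []       []       = ⊤
    Denotes* e (t ∷ ts) (d ∷ ds) = Denotes e t d × Denotes* e ts ds

  mutual
    Denotes-functional : ∀ {n} {e : Env n} t {d d'} → Denotes e t d → Denotes e t d' → ¬ ¬ d ≡ d'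
    Denotes-functional (var x) refl refl = pure refl
    Denotes-functional (fun f ts) (_ , ts↦ds , refl) (_ , ts↦ds' , refl) =
      cong (funI f) <$> Denotes*-functional ts ts↦ds ts↦ds'
    Denotes-functional (rfun f ts) (_ , ts↦ds , (φd , _)) (_ , ts↦ds' , (_ , uniq')) = do
      refl ← Denotes*-functional ts ts↦ds ts↦ds'
      uniq' _ φd

    Denotes*-functional : ∀ {n k} {e : Env n} ts {ds ds' : Vec Carrier k}
                        → Denotes* e ts ds → Denotes* e ts ds' → ¬ ¬ ds ≡ ds'
    Denotes*-functional []       {[]}    {[]}      _              _                = pure refl
    Denotes*-functional (t ∷ ts) {_ ∷ _} {_ ∷ _} (t↦d , ts↦ds) (t↦d' , ts↦ds') = do
      refl ← Denotes-functional t t↦d t↦d'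
      cong (_ ∷_) <$> Denotes*-functional ts ts↦ds ts↦ds'

  TermCont : ℕ → Set
  TermCont m = ∀ {m'} → Ren m m' → Term L m' → Formula L m'

  TermsCont : ℕ → ℕ → Set
  TermsCont m k = ∀ {m'} → Ren m m' → Vec (Term L m') k → Formula L m'

  Sat-repStep : ∀ {m} {e : Env m} f (us : Vec (Term L m) (rArity f)) (K : TermCont m)
              → (e ⊨ repStep L Rp f us K)
                ⟺ (¬ ¬ ∃ λ d → IsValue f (evals L M e us) d × (extend L M e d ⊨ K suc (var zero)))
  Sat-repStep f us K =
    ¬¬-cong-⇔ (Σ-cong-⇔ λ d → Unique-cong-⇔ (λ w → Sat-subF (λ where
                zero    → refl
                (suc i) → trans (eval-renT (λ _ → refl) (lookup us i)) (lookup-evals us i))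
              (defn f)) d
            ×-⇔ ⇔-id _)
    ⇔-∘ Sat-∃!∧∃ _ _

  -- expT hands the renaming into its enlarged context and the ordinary term replacing t to a
  -- continuation K; K Expresses Q specifies what the formula built by K means.
  _Expresses_ : ∀ {m} → TermCont m → (Env m → Carrier → Set) → Set
  K Expresses Q = ∀ {m'} (σ : Ren _ m') u (e : Env m') → (e ⊨ K σ u) ⟺ Q (e ∘ σ) (eval L M e u)

  _Expresses*_ : ∀ {m k} → TermsCont m k → (Env m → Vec Carrier k → Set) → Set
  K Expresses* Q = ∀ {m'} (σ : Ren _ m') us (e : Env m') → (e ⊨ K σ us) ⟺ Q (e ∘ σ) (evals L M e us)

  mutual
    Sat-expT : ∀ {n m} (t : XTerm L Rp n) (ρ : Ren n m) {K : TermCont m} {Q} → K Expresses Q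
             → ∀ e → (e ⊨ expT L Rp t ρ K) ⟺ (¬ ¬ ∃ λ d → Denotes (e ∘ ρ) t d × Q e d)
    Sat-expT (var x) ρ K≈Q e = mk⇔
      (λ Ke → pure (e (ρ x) , refl , K≈Q id (var (ρ x)) e .to Ke))
      (λ h → Sat-stable e _ do
        (_ , refl , Qd) ← h
        pure (K≈Q id (var (ρ x)) e .from Qd))
    Sat-expT (fun f ts) ρ {Q = Q} K≈Q e =
      ¬¬-cong-⇔ (mk⇔ (λ (ds , ts↦ds , Qd) → funI f ds , (ds , ts↦ds , refl) , Qd)
                     (λ { (_ , (ds , ts↦ds , refl) , Qd) → ds , ts↦ds , Qd }))
      ⇔-∘ Sat-expTs ts ρ {Q = λ e ds → Q e (funI f ds)} (λ σ us → K≈Q σ (fun f us)) e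
    Sat-expT (rfun f ts) ρ {K} {Q} K≈Q e =
      mk⇔ (λ h → do
            (ds , ts↦ds , h') ← h
            (d , f[ds]=d , Qd) ← h'
            pure (d , (ds , ts↦ds , f[ds]=d) , Qd))
          (λ h → do
            (d , (ds , ts↦ds , f[ds]=d) , Qd) ← h
            pure (ds , ts↦ds , pure (d , f[ds]=d , Qd)))
      ⇔-∘ Sat-expTs ts ρ {Q = λ e ds → ¬ ¬ ∃ λ d → IsValue f ds d × Q e d} step e
      where
        step : (λ σ us → repStep L Rp f us (λ τ → K (τ ∘ σ)))
                 Expresses* (λ e ds → ¬ ¬ ∃ λ d → IsValue f ds d × Q e d)
        step σ us e' =
          ¬¬-cong-⇔ (Σ-cong-⇔ λ d → ⇔-id _ ×-⇔ K≈Q (suc ∘ σ) (var zero) (extend L M e' d))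
          ⇔-∘ Sat-repStep f us (λ τ → K (τ ∘ σ))

    Sat-expTs : ∀ {n m k} (ts : Vec (XTerm L Rp n) k) (ρ : Ren n m) {K : TermsCont m k} {Q} → K Expresses* Q
              → ∀ e → (e ⊨ expTs L Rp ts ρ K) ⟺ (¬ ¬ ∃ λ ds → Denotes* (e ∘ ρ) ts ds × Q e ds)
    Sat-expTs [] ρ K≈Q e = mk⇔
      (λ Ke → pure ([] , _ , K≈Q id [] e .to Ke))
      (λ h → Sat-stable e _ do
        ([] , _ , Qds) ← h
        pure (K≈Q id [] e .from Qds))
    Sat-expTs (t ∷ ts) ρ {K} {Q} K≈Q e =
      mk⇔ (λ h → do
            (d , t↦d , h') ← h
            (ds , ts↦ds , Qdds) ← h'
            pure (d ∷ ds , (t↦d , ts↦ds) , Qdds))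
          (λ h → do
            (d ∷ ds , (t↦d , ts↦ds) , Qdds) ← h
            pure (d , t↦d , pure (ds , ts↦ds , Qdds)))
      ⇔-∘ Sat-expT t ρ {Q = λ e d → ¬ ¬ ∃ λ ds → Denotes* (e ∘ ρ) ts ds × Q e (d ∷ ds)} step e
      where
        step : (λ σ u → expTs L Rp ts (σ ∘ ρ) (λ τ us → K (τ ∘ σ) (renT L τ u ∷ us)))
                 Expresses (λ e d → ¬ ¬ ∃ λ ds → Denotes* (e ∘ ρ) ts ds × Q e (d ∷ ds))
        step σ u = Sat-expTs ts (σ ∘ ρ) λ τ us e' →
          ≡⇒⇔ (cong (λ a → Q (e' ∘ τ ∘ σ) (a ∷ evals L M e' us)) (eval-renT (λ _ → refl) u))
          ⇔-∘ K≈Q (τ ∘ σ) (renT L τ u ∷ us) e'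

  Sat-expF-≐ : ∀ {n} {e : Env n} t u
             → e ⊨ expF L Rp (t ≐ u) → ¬ ¬ ∃ λ a → ∃ λ b → Denotes e t a × Denotes e u b × a ≡ b
  Sat-expF-≐ {e = e} t u t≐u = do
      (a , t↦a , h) ← Sat-expT t id {Q = λ e a → ¬ ¬ ∃ λ b → Denotes e u b × ¬ ¬ a ≡ b} outer e
                        .to t≐u
      (b , u↦b , ¬¬a≡b) ← h
      a≡b ← ¬¬a≡b
      pure (a , b , t↦a , u↦b , a≡b)
    where
      inner : ∀ {m} (a : Term L m) → (λ τ b → renT L τ a ≐ b) Expresses (λ e b → ¬ ¬ eval L M e a ≡ b)
      inner a τ b e' = ¬¬-cong-⇔ (≡⇒⇔ (cong (_≡ eval L M e' b) (eval-renT (λ _ → refl) a)))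
      outer : (λ σ a → expT L Rp u σ (λ τ b → renT L τ a ≐ b))
                Expresses (λ e a → ¬ ¬ ∃ λ b → Denotes e u b × ¬ ¬ a ≡ b)
      outer σ a = Sat-expT u σ (inner a)

  Sat-expF-app : ∀ {n} {e : Env n} P t {a} → Denotes e t a
               → (e ⊨ expF L Rp (app P t)) ⟺ (const a ⊨ expF L Rp P)
  Sat-expF-app {e = e} P t t↦a =
    mk⇔ (λ h → Sat-stable _ (expF L Rp P) do
            (_ , t↦d , P[d]) ← h
            refl ← Denotes-functional t t↦d t↦a
            pure P[d])
        (λ P[a] → pure (_ , t↦a , P[a]))
    ⇔-∘ Sat-expT t id {Q = λ _ d → const d ⊨ expF L Rp P}
                  (λ _ _ _ → Sat-subF (λ { zero → refl }) (expF L Rp P)) e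

mainTheorem18 : (L : Lang) (Rp : Reps L) (r s : XTerm L Rp 0) (P : XFormula L Rp 1)
    → Valid L (expF L Rp (_⇒_ (_≐_ r s) (_⇔_ L Rp (app P r) (app P s))))
mainTheorem18 L Rp r s P M r≐s = Sat-stable _ (expF L Rp (_⇔_ L Rp (app P r) (app P s))) do
    (a , b , r↦a , s↦b , refl) ← Sat-expF-≐ r s r≐s
    let P[r]⇔P[s] = ⇔-sym (Sat-expF-app P s s↦b) ⇔-∘ Sat-expF-app P r r↦a
    pure (P[r]⇔P[s] .to , P[r]⇔P[s] .from)
  where
    open Expansion Rp M
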